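{- Let $(P,\mathcal{D})$ be a structured ordered set and let $U$ be an interdependent $\mathcal{D}$-orbit union. Then: (1) For all $x\in P\setminus U$ and all $C\in\mathcal{D}|U$: (a) if there is $c\in C$ with $c<x$, then $C<x$; (b) if there is $c\in C$ with $c>x$, then $C>x$. (2) For every $\Phi\in\mathrm{Aut}_{\mathcal{D}}(P)$ we have $\Phi|_U\in\mathrm{Aut}_{\mathcal{D}|U}(U)$; in particular the $\mathrm{Aut}_{\mathcal{D}|U}(U)$-orbits are exactly the sets in $\mathcal{D}|U$. (3) For every $\Psi\in\mathrm{Aut}_{\mathcal{D}|U}(U)$, the map $\Psi^P:P\to P$ given by $\Psi^P(x)=\Psi(x)$ for $x\in U$ and $\Psi^P(x)=x$ for $x\in P\setminus U$ is an automorphism of $P$.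
   Context: Ordered sets are finite. For $B,T\subseteq P$, $B<T$ means $b<t$ for all $b\in B,t\in T$ (braces omitted for singletons). A dictated orbit structure for $P$ is a partition $\mathcal{D}$ of $P$ into antichains; $(P,\mathcal{D})$ is a structured ordered set. $\mathrm{Aut}_{\mathcal{D}}(P)$ is the group of automorphisms $\Phi$ of $P$ such that every orbit of the cyclic group $\langle\Phi\rangle$ is contained in a single member of $\mathcal{D}$; its orbits are called $\mathcal{D}$-orbits. For $\mathcal{D}$-orbits $C,D$, write $C\upharpoonleft D$ iff there are $c_1\in C,d_1\in D$ with $c_1<d_1$ and $c_2\in C,d_2\in D$ that are incomparable; $C,D$ are directly interdependent iff $C\upharpoonleft D$ or $D\upharpoonleft C$. The orbit graph $\mathcal{O}(P,\mathcal{D})$ has the $\mathcal{D}$-orbits as vertices, adjacent iff directly interdependent; an interdependent $\mathcal{D}$-orbit union is the union of the vertex set of a connected component of $\mathcal{O}(P,\mathcal{D})$. If $U\subseteq P$ is a union of $\mathcal{D}$-orbits, $\mathcal{D}|U$ denotes the set of $\mathcal{D}$-orbits contained in $U$, a dictated orbit structure for the ordered subset $U$; $\mathrm{Aut}_{\mathcal{D}|U}(U)$ is defined for the ordered set $U$ with this structure. -}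

module Defs where

open import Level using (0ℓ)
open import Data.Nat using (ℕ; zero; suc)
open import Data.Bool using (Bool; T)
open import Data.Product using (Σ; _×_; _,_; proj₁; ∃)
open import Data.Sum using (_⊎_)
open import Relation.Nullary using (¬_)
open import Relation.Binary using (Rel; IsPartialOrder; IsEquivalence)
open import Relation.Binary.PropositionalEquality using (_≡_; _≢_)
open import Relation.Binary.Construct.Closure.ReflexiveTransitive using (Star)

-- A dictated orbit structure is a partition of the carrier into antichains,
-- represented by its equivalence relation _∼_ ("lie in the same member of 𝒟").
record IsDictatedOrbitStructure {A : Set} (_≤_ : Rel A 0ℓ) (_∼_ : Rel A 0ℓ) : Set where
  field
    isEquivalence : IsEquivalence _∼_
    antichain     : ∀ {x y} → x ∼ y → x ≤ y → x ≡ y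

_<[_]_ : {A : Set} → A → Rel A 0ℓ → A → Set
x <[ _≤_ ] y = (x ≤ y) × (x ≢ y)

Incomparable : {A : Set} → Rel A 0ℓ → A → A → Set
Incomparable _≤_ x y = ¬ (x ≤ y) × ¬ (y ≤ x)

iterate : {A : Set} → (A → A) → ℕ → A → A
iterate f zero    x = x
iterate f (suc k) x = f (iterate f k x)

record Aut {A : Set} (_≤_ : Rel A 0ℓ) : Set where
  field
    fun      : A → A
    inv      : A → A
    inv-left  : ∀ x → inv (fun x) ≡ x
    inv-right : ∀ x → fun (inv x) ≡ x
    preserve : ∀ {x y} → x ≤ y → fun x ≤ fun y
    reflect  : ∀ {x y} → fun x ≤ fun y → x ≤ y
open Aut public

-- y lies in the orbit of x under the cyclic group ⟨Φ⟩ (powers Φ^k, k ∈ ℤ).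
InCyclicOrbit : {A : Set} {_≤_ : Rel A 0ℓ} → Aut _≤_ → A → A → Set
InCyclicOrbit Φ x y =
  Σ ℕ (λ k → (iterate (fun Φ) k x ≡ y) ⊎ (iterate (inv Φ) k x ≡ y))

record AutD {A : Set} (_≤_ : Rel A 0ℓ) (_∼_ : Rel A 0ℓ) : Set where
  field
    aut        : Aut _≤_
    respects𝒟 : ∀ x y → InCyclicOrbit aut x y → x ∼ y
open AutD public

SameDOrbit : {A : Set} (_≤_ : Rel A 0ℓ) (_∼_ : Rel A 0ℓ) → A → A → Set
SameDOrbit _≤_ _∼_ x y = Σ (AutD _≤_ _∼_) (λ Φ → fun (aut Φ) x ≡ y)

Up : {A : Set} (_≤_ : Rel A 0ℓ) (_∼_ : Rel A 0ℓ) → A → A → Set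
Up _≤_ _∼_ a b =
  Σ _ λ c₁ → Σ _ λ d₁ → Σ _ λ c₂ → Σ _ λ d₂ →
    SameDOrbit _≤_ _∼_ a c₁ × SameDOrbit _≤_ _∼_ b d₁ × (c₁ <[ _≤_ ] d₁) ×
    SameDOrbit _≤_ _∼_ a c₂ × SameDOrbit _≤_ _∼_ b d₂ × Incomparable _≤_ c₂ d₂

DirectlyInterdependent : {A : Set} (_≤_ : Rel A 0ℓ) (_∼_ : Rel A 0ℓ) → A → A → Set
DirectlyInterdependent _≤_ _∼_ a b = Up _≤_ _∼_ a b ⊎ Up _≤_ _∼_ b a

-- One step in the orbit graph, on representatives: same vertex, or adjacent vertices.
OrbitGraphStep : {A : Set} (_≤_ : Rel A 0ℓ) (_∼_ : Rel A 0ℓ) → A → A → Set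
OrbitGraphStep _≤_ _∼_ a b = SameDOrbit _≤_ _∼_ a b ⊎ DirectlyInterdependent _≤_ _∼_ a b

-- The 𝒟-orbits of a and b lie in the same connected component of 𝒪(P,𝒟).
Connected : {A : Set} (_≤_ : Rel A 0ℓ) (_∼_ : Rel A 0ℓ) → A → A → Set
Connected _≤_ _∼_ = Star (OrbitGraphStep _≤_ _∼_)

-- U (given by its characteristic function) is an interdependent 𝒟-orbit union:
-- it is the union of the vertex set of the component containing the orbit of some a.
IsInterdependentOrbitUnion : {A : Set} (_≤_ : Rel A 0ℓ) (_∼_ : Rel A 0ℓ) → (A → Bool) → Set
IsInterdependentOrbitUnion _≤_ _∼_ u =
  Σ _ λ a → ∀ x → (T (u x) → Connected _≤_ _∼_ a x) × (Connected _≤_ _∼_ a x → T (u x))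

-- The ordered subset U and the structure 𝒟|U (the 𝒟-orbits contained in U).
Sub : {A : Set} → (A → Bool) → Set
Sub {A} u = Σ A (λ x → T (u x))

restrictOrder : {A : Set} (_≤_ : Rel A 0ℓ) (u : A → Bool) → Rel (Sub u) 0ℓ
restrictOrder _≤_ u p q = proj₁ p ≤ proj₁ q

restrictStructure : {A : Set} (_≤_ : Rel A 0ℓ) (_∼_ : Rel A 0ℓ) (u : A → Bool) → Rel (Sub u) 0ℓ
restrictStructure _≤_ _∼_ u p q = SameDOrbit _≤_ _∼_ (proj₁ p) (proj₁ q)

{-# OPTIONS --safe #-}
module Submission where

open import Defs
open import Data.Nat using (ℕ; zero; suc)
open import Data.Fin using (Fin)
open import Data.Bool using (Bool; T; false)
open import Data.Bool.Properties using (T?; T-irrelevant)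
open import Data.Product using (Σ; _×_; _,_; proj₁; proj₂)
open import Data.Sum using (inj₁; inj₂)
open import Relation.Nullary using (¬_; yes; no; contradiction)
open import Relation.Binary using (Rel; IsPartialOrder; IsEquivalence; Decidable)
open import Relation.Binary.PropositionalEquality
  using (_≡_; refl; sym; trans; cong; subst; subst₂)
open import Relation.Binary.Construct.Closure.ReflexiveTransitive using (ε; _◅_; _◅◅_)
open import Function using (_⇔_; mk⇔)
open import Level using (0ℓ)

-- Let x ∉ U be comparable with some c in a 𝒟-orbit C ⊆ U, say c < x, and let c′ ∈ C.
-- Then x ≤ c′ is impossible, since c < c′ would contradict that C lies in an antichain,
-- and incomparability of c′ and x is impossible, since then C ↿ (orbit of x), which would
-- put x into the component U.  So C < x.  Consequently a 𝒟|U-automorphism of U, extended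
-- by the identity outside U, still preserves every comparability across the boundary of U;
-- and restricting a 𝒟-automorphism to U is possible because U is a union of 𝒟-orbits.

module AutGroup {A : Set} (_≤_ : Rel A 0ℓ) where

  Aut-id : Aut _≤_
  Aut-id = record
    { fun = λ x → x ; inv = λ x → x ; inv-left = λ _ → refl ; inv-right = λ _ → refl
    ; preserve = λ le → le ; reflect = λ le → le }

  Aut-compose : Aut _≤_ → Aut _≤_ → Aut _≤_
  Aut-compose Φ Ψ = record
    { fun = λ x → fun Ψ (fun Φ x) ; inv = λ x → inv Φ (inv Ψ x)
    ; inv-left = λ x → trans (cong (inv Φ) (inv-left Ψ _)) (inv-left Φ x)
    ; inv-right = λ x → trans (cong (fun Ψ) (inv-right Φ _)) (inv-right Ψ x)
    ; preserve = λ le → preserve Ψ (preserve Φ le)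
    ; reflect = λ le → reflect Φ (reflect Ψ le) }

  Aut-inverse : Aut _≤_ → Aut _≤_
  Aut-inverse Φ = record
    { fun = inv Φ ; inv = fun Φ ; inv-left = inv-right Φ ; inv-right = inv-left Φ
    ; preserve = λ {x} {y} le →
        reflect Φ (subst₂ _≤_ (sym (inv-right Φ x)) (sym (inv-right Φ y)) le)
    ; reflect = λ {x} {y} le → subst₂ _≤_ (inv-right Φ x) (inv-right Φ y) (preserve Φ le) }

module OrbitRelation {A : Set} (_≤_ : Rel A 0ℓ) (_∼_ : Rel A 0ℓ) (∼-isEquivalence : IsEquivalence _∼_) where
  open IsEquivalence ∼-isEquivalence renaming (refl to ∼-refl; sym to ∼-sym; trans to ∼-trans)
  open AutGroup _≤_

  ∼-iterate : (f : A → A) → (∀ x → x ∼ f x) → ∀ k x → x ∼ iterate f k x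
  ∼-iterate f x∼fx zero    x = ∼-refl
  ∼-iterate f x∼fx (suc k) x = ∼-trans (∼-iterate f x∼fx k x) (x∼fx _)

  -- An automorphism moving every point within its member of 𝒟 lies in Aut_𝒟,
  -- since then all its powers (positive and negative) do as well.
  mkAutD : (Φ : Aut _≤_) → (∀ x → x ∼ fun Φ x) → AutD _≤_ _∼_
  mkAutD Φ x∼Φx = record { aut = Φ ; respects𝒟 = respects }
    where
    x∼Φ⁻¹x : ∀ x → x ∼ inv Φ x
    x∼Φ⁻¹x x = subst (_∼ inv Φ x) (inv-right Φ x) (∼-sym (x∼Φx (inv Φ x)))
    respects : ∀ x y → InCyclicOrbit Φ x y → x ∼ y
    respects x y (k , inj₁ e) = subst (x ∼_) e (∼-iterate (fun Φ) x∼Φx k x)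
    respects x y (k , inj₂ e) = subst (x ∼_) e (∼-iterate (inv Φ) x∼Φ⁻¹x k x)

  AutD-∼ : (Φ : AutD _≤_ _∼_) → ∀ x → x ∼ fun (aut Φ) x
  AutD-∼ Φ x = respects𝒟 Φ x _ (1 , inj₁ refl)

  AutD-inverse : AutD _≤_ _∼_ → AutD _≤_ _∼_
  AutD-inverse Φ = mkAutD (Aut-inverse (aut Φ)) λ x →
    subst (_∼ inv (aut Φ) x) (inv-right (aut Φ) x) (∼-sym (AutD-∼ Φ (inv (aut Φ) x)))

  SameDOrbit-refl : ∀ x → SameDOrbit _≤_ _∼_ x x
  SameDOrbit-refl x = mkAutD Aut-id (λ _ → ∼-refl) , refl

  SameDOrbit-sym : ∀ {x y} → SameDOrbit _≤_ _∼_ x y → SameDOrbit _≤_ _∼_ y x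
  SameDOrbit-sym {x} (Φ , Φx≡y) =
    AutD-inverse Φ , trans (cong (inv (aut Φ)) (sym Φx≡y)) (inv-left (aut Φ) x)

  SameDOrbit-trans : ∀ {x y z} → SameDOrbit _≤_ _∼_ x y → SameDOrbit _≤_ _∼_ y z →
                     SameDOrbit _≤_ _∼_ x z
  SameDOrbit-trans (Φ , Φx≡y) (Ψ , Ψy≡z) =
    mkAutD (Aut-compose (aut Φ) (aut Ψ)) (λ x → ∼-trans (AutD-∼ Φ x) (AutD-∼ Ψ _)) ,
    trans (cong (fun (aut Ψ)) Φx≡y) Ψy≡z

  SameDOrbit⇒∼ : ∀ {x y} → SameDOrbit _≤_ _∼_ x y → x ∼ y
  SameDOrbit⇒∼ {x} (Φ , Φx≡y) = subst (x ∼_) Φx≡y (AutD-∼ Φ x)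

module InterdependentOrbitUnion
    {A : Set} (_≤_ : Rel A 0ℓ) (≤-isPartialOrder : IsPartialOrder _≡_ _≤_) (_≤?_ : Decidable _≤_)
    (_∼_ : Rel A 0ℓ) (𝒟 : IsDictatedOrbitStructure _≤_ _∼_)
    (u : A → Bool) (u-isUnion : IsInterdependentOrbitUnion _≤_ _∼_ u) where

  open IsPartialOrder ≤-isPartialOrder using () renaming (trans to ≤-trans)
  open IsDictatedOrbitStructure 𝒟 using (antichain; isEquivalence)
  open IsEquivalence isEquivalence using () renaming (refl to ∼-refl; sym to ∼-sym)
  open OrbitRelation _≤_ _∼_ isEquivalence

  Same : Rel A 0ℓ
  Same = SameDOrbit _≤_ _∼_

  ∈U-step : ∀ {c y} → T (u c) → OrbitGraphStep _≤_ _∼_ c y → T (u y)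
  ∈U-step c∈U step = from (to c∈U ◅◅ (step ◅ ε))
    where
    a : A
    a = proj₁ u-isUnion
    to : ∀ {x} → T (u x) → Connected _≤_ _∼_ a x
    to {x} = proj₁ (proj₂ u-isUnion x)
    from : ∀ {x} → Connected _≤_ _∼_ a x → T (u x)
    from {x} = proj₂ (proj₂ u-isUnion x)

  ∈U-Same : ∀ {c y} → T (u c) → Same c y → T (u y)
  ∈U-Same c∈U s = ∈U-step c∈U (inj₁ s)

  orbit-below : ∀ x c → ¬ T (u x) → T (u c) →
                c <[ _≤_ ] x → ∀ c′ → Same c c′ → c′ <[ _≤_ ] x
  orbit-below x c x∉U c∈U c<x@(c≤x , _) c′ c~c′ = c′≤x , c′≢x
    where
    c′≢x : ¬ c′ ≡ x
    c′≢x refl = x∉U (∈U-Same c∈U c~c′)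
    c′≤x : c′ ≤ x
    c′≤x with c′ ≤? x | x ≤? c′
    ... | yes c′≤x | _ = c′≤x
    ... | no c′≰x | yes x≤c′ =
      contradiction (subst (_≤ x) (antichain (SameDOrbit⇒∼ c~c′) (≤-trans c≤x x≤c′)) c≤x) c′≰x
    ... | no c′≰x | no x≰c′ = contradiction (∈U-step c∈U (inj₂ (inj₁ C↿x))) x∉U
      where
      C↿x : Up _≤_ _∼_ c x
      C↿x = c , x , c′ , x , SameDOrbit-refl c , SameDOrbit-refl x , c<x ,
            c~c′ , SameDOrbit-refl x , c′≰x , x≰c′

  orbit-above : ∀ x c → ¬ T (u x) → T (u c) →
                x <[ _≤_ ] c → ∀ c′ → Same c c′ → x <[ _≤_ ] c′
  orbit-above x c x∉U c∈U x<c@(x≤c , _) c′ c~c′ = x≤c′ , x≢c′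
    where
    x≢c′ : ¬ x ≡ c′
    x≢c′ refl = x∉U (∈U-Same c∈U c~c′)
    x≤c′ : x ≤ c′
    x≤c′ with x ≤? c′ | c′ ≤? x
    ... | yes x≤c′ | _ = x≤c′
    ... | no x≰c′ | yes c′≤x =
      contradiction (subst (x ≤_) (sym (antichain (∼-sym (SameDOrbit⇒∼ c~c′)) (≤-trans c′≤x x≤c)))
                                   x≤c) x≰c′
    ... | no x≰c′ | no c′≰x = contradiction (∈U-step c∈U (inj₂ (inj₂ x↿C))) x∉U
      where
      x↿C : Up _≤_ _∼_ x c
      x↿C = x , c , x , c′ , SameDOrbit-refl x , SameDOrbit-refl c , x<c ,
            SameDOrbit-refl x , c~c′ , x≰c′ , c′≰x

  _≤U_ : Rel (Sub u) 0ℓ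
  _≤U_ = restrictOrder _≤_ u

  _∼U_ : Rel (Sub u) 0ℓ
  _∼U_ = restrictStructure _≤_ _∼_ u

  ∼U-isEquivalence : IsEquivalence _∼U_
  ∼U-isEquivalence = record
    { refl = SameDOrbit-refl _ ; sym = SameDOrbit-sym ; trans = SameDOrbit-trans }

  module OrbitRelationU = OrbitRelation _≤U_ _∼U_ ∼U-isEquivalence

  Sub-≡ : {p q : Sub u} → proj₁ p ≡ proj₁ q → p ≡ q
  Sub-≡ {x , x∈U} {.x , x∈U′} refl = cong (x ,_) (T-irrelevant x∈U x∈U′)

  restrict : AutD _≤_ _∼_ → Sub u → Sub u
  restrict Φ (x , x∈U) = fun (aut Φ) x , ∈U-Same x∈U (Φ , refl)

  restrictAutD : AutD _≤_ _∼_ → AutD _≤U_ _∼U_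
  restrictAutD Φ = OrbitRelationU.mkAutD Φ|U (λ p → Φ , refl)
    where
    Φ|U : Aut _≤U_
    Φ|U = record
      { fun = restrict Φ ; inv = restrict (AutD-inverse Φ)
      ; inv-left = λ p → Sub-≡ (inv-left (aut Φ) (proj₁ p))
      ; inv-right = λ p → Sub-≡ (inv-right (aut Φ) (proj₁ p))
      ; preserve = preserve (aut Φ) ; reflect = reflect (aut Φ) }

  extend : (Sub u → Sub u) → A → A
  extend f x with T? (u x)
  ... | yes x∈U = proj₁ (f (x , x∈U))
  ... | no _    = x

  extend-∈U : ∀ f x (x∈U : T (u x)) → extend f x ≡ proj₁ (f (x , x∈U))
  extend-∈U f x x∈U with T? (u x)
  ... | yes x∈U′ = cong (λ x∈U″ → proj₁ (f (x , x∈U″))) (T-irrelevant x∈U′ x∈U)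
  ... | no x∉U   = contradiction x∈U x∉U

  extend-∉U : ∀ f x → ¬ T (u x) → extend f x ≡ x
  extend-∉U f x x∉U with T? (u x)
  ... | yes x∈U = contradiction x∈U x∉U
  ... | no _    = refl

  extend-inverseˡ : ∀ f g → (∀ p → g (f p) ≡ p) → ∀ x → extend g (extend f x) ≡ x
  extend-inverseˡ f g gf≡id x with T? (u x)
  ... | yes x∈U = trans (extend-∈U g _ (proj₂ (f (x , x∈U)))) (cong proj₁ (gf≡id (x , x∈U)))
  ... | no x∉U  = extend-∉U g x x∉U

  extend-preserves : ∀ f → (∀ {p q} → p ≤U q → f p ≤U f q) → (∀ p → p ∼U f p) →
                     ∀ {x y} → x ≤ y → extend f x ≤ extend f y
  extend-preserves f f-mono p∼fp {x} {y} x≤y with T? (u x) | T? (u y)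
  ... | yes x∈U | yes y∈U = f-mono x≤y
  ... | yes x∈U | no y∉U  =
    proj₁ (orbit-below y x y∉U x∈U (x≤y , λ { refl → y∉U x∈U }) _ (p∼fp (x , x∈U)))
  ... | no x∉U  | yes y∈U =
    proj₁ (orbit-above x y x∉U y∈U (x≤y , λ { refl → x∉U y∈U }) _ (p∼fp (y , y∈U)))
  ... | no _    | no _    = x≤y

  extendAut : AutD _≤U_ _∼U_ → Aut _≤_
  extendAut Ψ = record
    { fun = Ψᴾ ; inv = Ψ⁻¹ᴾ
    ; inv-left = inv-left′
    ; inv-right = extend-inverseˡ (inv (aut Ψ)) (fun (aut Ψ)) (inv-right (aut Ψ))
    ; preserve = extend-preserves (fun (aut Ψ)) (preserve (aut Ψ)) (OrbitRelationU.AutD-∼ Ψ)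
    ; reflect = λ {x} {y} Ψᴾx≤Ψᴾy →
        subst₂ _≤_ (inv-left′ x) (inv-left′ y) (extend-preserves (inv (aut Ψ))
          (preserve (aut Ψ⁻¹)) (OrbitRelationU.AutD-∼ Ψ⁻¹) Ψᴾx≤Ψᴾy) }
    where
    Ψᴾ Ψ⁻¹ᴾ : A → A
    Ψᴾ = extend (fun (aut Ψ))
    Ψ⁻¹ᴾ = extend (inv (aut Ψ))
    Ψ⁻¹ : AutD _≤U_ _∼U_
    Ψ⁻¹ = OrbitRelationU.AutD-inverse Ψ
    inv-left′ : ∀ x → Ψ⁻¹ᴾ (Ψᴾ x) ≡ x
    inv-left′ = extend-inverseˡ (fun (aut Ψ)) (inv (aut Ψ)) (inv-left (aut Ψ))

  extendAutD : AutD _≤U_ _∼U_ → AutD _≤_ _∼_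
  extendAutD Ψ = mkAutD (extendAut Ψ) x∼Ψᴾx
    where
    x∼Ψᴾx : ∀ x → x ∼ extend (fun (aut Ψ)) x
    x∼Ψᴾx x with T? (u x)
    ... | yes x∈U = SameDOrbit⇒∼ (OrbitRelationU.AutD-∼ Ψ (x , x∈U))
    ... | no _    = ∼-refl

  SameDOrbitU⇔SameDOrbit : ∀ p q → SameDOrbit _≤U_ _∼U_ p q ⇔ p ∼U q
  SameDOrbitU⇔SameDOrbit (x , x∈U) q = mk⇔
    (λ { (Ψ , Ψp≡q) → extendAutD Ψ , trans (extend-∈U (fun (aut Ψ)) x x∈U) (cong proj₁ Ψp≡q) })
    (λ { (Φ , Φx≡y) → restrictAutD Φ , Sub-≡ Φx≡y })

proposition3p7 :
    (n : ℕ) (_≤_ : Rel (Fin n) 0ℓ) → IsPartialOrder _≡_ _≤_ → Decidable _≤_ →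
    (_∼_ : Rel (Fin n) 0ℓ) → IsDictatedOrbitStructure _≤_ _∼_ →
    (u : Fin n → Bool) → IsInterdependentOrbitUnion _≤_ _∼_ u →
    -- (1)
    (∀ x c → u x ≡ false → T (u c) →
       ((c <[ _≤_ ] x) → ∀ c′ → SameDOrbit _≤_ _∼_ c c′ → c′ <[ _≤_ ] x) ×
       ((x <[ _≤_ ] c) → ∀ c′ → SameDOrbit _≤_ _∼_ c c′ → x <[ _≤_ ] c′))
    ×
    -- (2)
    ((∀ (Φ : AutD _≤_ _∼_) →
       Σ (AutD (restrictOrder _≤_ u) (restrictStructure _≤_ _∼_ u)) λ Ψ →
         ∀ p → proj₁ (fun (aut Ψ) p) ≡ fun (aut Φ) (proj₁ p))
     ×
     (∀ (p q : Sub u) →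
       SameDOrbit (restrictOrder _≤_ u) (restrictStructure _≤_ _∼_ u) p q ⇔
       restrictStructure _≤_ _∼_ u p q))
    ×
    -- (3)
    (∀ (Ψ : AutD (restrictOrder _≤_ u) (restrictStructure _≤_ _∼_ u)) →
       Σ (Aut _≤_) λ Ψᴾ →
         (∀ x (p : T (u x)) → fun Ψᴾ x ≡ proj₁ (fun (aut Ψ) (x , p))) ×
         (∀ x → u x ≡ false → fun Ψᴾ x ≡ x))
proposition3p7 n _≤_ ≤-po _≤?_ _∼_ 𝒟 u u-isUnion =
  (λ x c ux≡false c∈U → orbit-below x c (∉U ux≡false) c∈U , orbit-above x c (∉U ux≡false) c∈U) ,
  ((λ Φ → restrictAutD Φ , λ _ → refl) , SameDOrbitU⇔SameDOrbit) ,
  (λ Ψ → extendAut Ψ , extend-∈U (fun (aut Ψ)) , λ x ux≡false → extend-∉U (fun (aut Ψ)) x (∉U ux≡false))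
  where
  open InterdependentOrbitUnion _≤_ ≤-po _≤?_ _∼_ 𝒟 u u-isUnion
  ∉U : ∀ {x} → u x ≡ false → ¬ T (u x)
  ∉U ux≡false = subst T ux≡false
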